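{- Let $s$ be a positive even integer and $\mathfrak{S}\subseteq(\mathbb{Z}/s\mathbb{Z})^2$. Define $$\mathcal{N}(\mathfrak{S})=\left\{\tfrac32(\alpha-\beta)+\beta \bmod s/2 \;:\; (\alpha,\beta)\in\mathfrak{S},\ \alpha\equiv\beta\pmod 2\right\}.$$ Assume $\mathcal{N}(\mathfrak{S})$ is a complete set of residues modulo $s/2$. Then for every $N\in\mathbb{N}$ there is a residue $r_{N,s}$ modulo $3s$ such that for every integer $b\equiv r_{N,s}\pmod{3s}$, setting $a=\frac23(N-b)+b$, one has $N\equiv b\pmod 3$, $a\equiv b\pmod 2$, and $(a,b)\bmod s\in\mathfrak{S}$.
   Context: Since $s$ is even, parity of residues mod $s$ is well defined, and for $\alpha\equiv\beta\pmod 2$ the quantity $\frac32(\alpha-\beta)+\beta$ is well defined modulo $s/2$. -}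

module Defs where

open import Data.Nat as ℕ using (ℕ; NonZero)
open import Data.Nat.Properties using (m*n≢0)
open import Data.Integer as ℤ using (ℤ; +_; _%ℕ_)
open import Data.Integer.DivMod using (n%ℕd<d)
open import Data.Fin using (Fin; fromℕ<; toℕ)
open import Data.Product using (Σ; _×_; ∃₂)
open import Relation.Binary.PropositionalEquality using (_≡_)

-- Residues modulo n are represented by Fin n (canonical representatives 0..n-1).
-- reduce i n  =  i mod n  as an element of Z/nZ.
reduce : ℤ → (n : ℕ) .{{_ : NonZero n}} → Fin n
reduce i n = fromℕ< (n%ℕd<d i n)

lift : ∀ {n} → Fin n → ℤ
lift x = + (toℕ x)

-- positivity of s = 2h and of 3s (plain functions, not instances, to avoid instance loops)
nz-2* : ∀ h .{{_ : NonZero h}} → NonZero (2 ℕ.* h)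
nz-2* h {{p}} = m*n≢0 2 h {{_}} {{p}}

nz-3* : ∀ h .{{_ : NonZero h}} → NonZero (3 ℕ.* (2 ℕ.* h))
nz-3* h {{p}} = m*n≢0 3 (2 ℕ.* h) {{_}} {{nz-2* h {{p}}}}

reduceₛ : ∀ h .{{_ : NonZero h}} → ℤ → Fin (2 ℕ.* h)
reduceₛ h {{p}} i = reduce i (2 ℕ.* h) {{nz-2* h {{p}}}}

reduce₃ₛ : ∀ h .{{_ : NonZero h}} → ℤ → Fin (3 ℕ.* (2 ℕ.* h))
reduce₃ₛ h {{p}} i = reduce i (3 ℕ.* (2 ℕ.* h)) {{nz-3* h {{p}}}}

-- Throughout, s = 2 * h with h ≥ 1, so s/2 = h.
-- A subset 𝔖 ⊆ (Z/sZ)² is a predicate on pairs of residues.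

-- c ∈ 𝒩(𝔖): there is (α,β) ∈ 𝔖 with α ≡ β (mod 2) such that
-- (3/2)(α - β) + β ≡ c (mod s/2); here (α-β) = 2q and (3/2)(α-β) = 3q.
-- (Well defined by the context remark; we use canonical representatives.)
_∈𝒩_ : ∀ {h} .{{_ : NonZero h}} → Fin h → (Fin (2 ℕ.* h) → Fin (2 ℕ.* h) → Set) → Set
_∈𝒩_ {h} c 𝔖 =
  ∃₂ λ α β → 𝔖 α β
    × (toℕ α ℕ.% 2 ≡ toℕ β ℕ.% 2)
    × Σ ℤ (λ q → (lift α ℤ.- lift β ≡ q ℤ.* + 2)
                 × (reduce (+ 3 ℤ.* q ℤ.+ lift β) h ≡ c))

CompleteResidues𝒩 : ∀ {h} .{{_ : NonZero h}} → (Fin (2 ℕ.* h) → Fin (2 ℕ.* h) → Set) → Set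
CompleteResidues𝒩 {h} 𝔖 = (c : Fin h) → c ∈𝒩 𝔖

-- Choose (α, β) ∈ 𝔖 whose value 3q₀ + β, with α − β = 2q₀, represents N modulo h = s/2,
-- say N = 3q₀ + β − kh.  Every b = β − 4kh + 6hj then has N − b = 3q with q = q₀ + kh − 2hj,
-- so b ≡ β and a = 2q + b ≡ α (mod 2h); a ≡ b (mod 2) holds because a − b = 2q.
module Submission where

open import Defs
open import Data.Nat as ℕ using (ℕ; NonZero)
open import Data.Integer as ℤ using (ℤ; +_; _%ℕ_)
open import Data.Fin using (Fin)
open import Data.Product using (Σ; _×_)
open import Relation.Binary.PropositionalEquality using (_≡_)

open import Data.Product using (_,_)
open import Data.Fin using (toℕ)
open import Data.Fin.Properties using (toℕ-injective; toℕ-fromℕ<; toℕ<n)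
open import Data.Integer using (_+_; _-_; _*_; ∣_∣; _/ℕ_)
open import Data.Integer.DivMod using (a≡a%ℕn+[a/ℕn]*n; n%ℕd<d)
open import Data.Integer.Tactic.RingSolver using (solve-∀)
import Data.Integer.Properties as ℤ
import Data.Nat.Properties as ℕ
open import Data.Nat.DivMod using (m<n⇒m%n≡m)
open import Relation.Binary.PropositionalEquality
  using (refl; sym; trans; cong; cong₂; subst; subst₂; module ≡-Reasoning)

infix 4 _≡_mod_

record _≡_mod_ (x y : ℤ) (n : ℕ) : Set where
  constructor congruence
  field
    quotient   : ℤ
    difference : x - y ≡ quotient * + n

open _≡_mod_ using (quotient)

remainder-unique : ∀ {n r r′} (k k′ : ℤ) → r ℕ.< n → r′ ℕ.< n →
                   + r + k * + n ≡ + r′ + k′ * + n → r ≡ r′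
remainder-unique {n} {r} {r′} k k′ r<n r′<n eq =
  ℤ.+-injective (ℤ.i-j≡0⇒i≡j (+ r) (+ r′) (ℤ.∣i∣≡0⇒i≡0 ∣r-r′∣≡0))
  where
  open ≡-Reasoning

  r-r′≡[k′-k]n : + r - + r′ ≡ (k′ - k) * + n
  r-r′≡[k′-k]n = begin
    + r - + r′                                ≡⟨ cancel (+ r) (+ r′) (k * + n) ⟩
    (+ r + k * + n) - (+ r′ + k * + n)        ≡⟨ cong (_- (+ r′ + k * + n)) eq ⟩
    (+ r′ + k′ * + n) - (+ r′ + k * + n)      ≡⟨ collect (+ r′) k k′ (+ n) ⟩
    (k′ - k) * + n                            ∎
    where
    cancel : ∀ x y z → x - y ≡ (x + z) - (y + z)
    cancel = solve-∀
    collect : ∀ x k k′ n → (x + k′ * n) - (x + k * n) ≡ (k′ - k) * n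
    collect = solve-∀

  ∣r-r′∣<n : ∣ + r - + r′ ∣ ℕ.< n
  ∣r-r′∣<n = subst (ℕ._< n) (cong ∣_∣ (sym (ℤ.m-n≡m⊖n r r′)))
                  (ℕ.≤-<-trans (ℤ.∣m⊝n∣≤m⊔n r r′) (ℕ.⊔-pres-<m r<n r′<n))

  ∣r-r′∣≡∣k′-k∣n : ∣ + r - + r′ ∣ ≡ ∣ k′ - k ∣ ℕ.* n
  ∣r-r′∣≡∣k′-k∣n = trans (cong ∣_∣ r-r′≡[k′-k]n) (ℤ.abs-* (k′ - k) (+ n))

  ∣k′-k∣≡0 : ∣ k′ - k ∣ ≡ 0
  ∣k′-k∣≡0 = ℕ.n<1⇒n≡0 (ℕ.*-cancelʳ-< n _ 1
    (subst (ℕ._< 1 ℕ.* n) ∣r-r′∣≡∣k′-k∣n (subst (_ ℕ.<_) (sym (ℕ.*-identityˡ n)) ∣r-r′∣<n)))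

  ∣r-r′∣≡0 : ∣ + r - + r′ ∣ ≡ 0
  ∣r-r′∣≡0 = trans ∣r-r′∣≡∣k′-k∣n (cong (ℕ._* n) ∣k′-k∣≡0)

module _ {n : ℕ} .{{_ : NonZero n}} where

  ≡-mod⇒%ℕ-≡ : ∀ x y → x ≡ y mod n → x %ℕ n ≡ y %ℕ n
  ≡-mod⇒%ℕ-≡ x y (congruence k x-y≡kn) =
    remainder-unique (x /ℕ n) (y /ℕ n + k) (n%ℕd<d x n) (n%ℕd<d y n) (begin
      + (x %ℕ n) + (x /ℕ n) * + n            ≡⟨ sym (a≡a%ℕn+[a/ℕn]*n x n) ⟩
      x                                       ≡⟨ split x y ⟩
      y + (x - y)                             ≡⟨ cong₂ _+_ (a≡a%ℕn+[a/ℕn]*n y n) x-y≡kn ⟩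
      (+ (y %ℕ n) + (y /ℕ n) * + n) + k * + n ≡⟨ regroup (+ (y %ℕ n)) (y /ℕ n) k (+ n) ⟩
      + (y %ℕ n) + (y /ℕ n + k) * + n         ∎)
    where
    open ≡-Reasoning
    split : ∀ x y → x ≡ y + (x - y)
    split = solve-∀
    regroup : ∀ r q k n → (r + q * n) + k * n ≡ r + (q + k) * n
    regroup = solve-∀

  %ℕ-≡⇒≡-mod : ∀ x y → x %ℕ n ≡ y %ℕ n → x ≡ y mod n
  %ℕ-≡⇒≡-mod x y x%n≡y%n = congruence (x /ℕ n - y /ℕ n) (begin
      x - y                                                     ≡⟨ cong₂ _-_ (a≡a%ℕn+[a/ℕn]*n x n) (a≡a%ℕn+[a/ℕn]*n y n) ⟩
      (+ (x %ℕ n) + (x /ℕ n) * + n) - (+ (y %ℕ n) + (y /ℕ n) * + n) ≡⟨ cong (λ r → (+ r + (x /ℕ n) * + n) - (+ (y %ℕ n) + (y /ℕ n) * + n)) x%n≡y%n ⟩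
      (+ (y %ℕ n) + (x /ℕ n) * + n) - (+ (y %ℕ n) + (y /ℕ n) * + n) ≡⟨ collect (+ (y %ℕ n)) (x /ℕ n) (y /ℕ n) (+ n) ⟩
      (x /ℕ n - y /ℕ n) * + n                                   ∎)
    where
    open ≡-Reasoning
    collect : ∀ r q q′ n → (r + q * n) - (r + q′ * n) ≡ (q - q′) * n
    collect = solve-∀

  toℕ-reduce : ∀ x → toℕ (reduce x n) ≡ x %ℕ n
  toℕ-reduce x = toℕ-fromℕ< (n%ℕd<d x n)

  reduce-cong : ∀ {x y} → x ≡ y mod n → reduce x n ≡ reduce y n
  reduce-cong {x} {y} x≡y = toℕ-injective
    (trans (toℕ-reduce x) (trans (≡-mod⇒%ℕ-≡ x y x≡y) (sym (toℕ-reduce y))))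

  reduce-injective : ∀ x y → reduce x n ≡ reduce y n → x ≡ y mod n
  reduce-injective x y eq = %ℕ-≡⇒≡-mod x y
    (trans (sym (toℕ-reduce x)) (trans (cong toℕ eq) (toℕ-reduce y)))

  reduce-lift : (γ : Fin n) → reduce (lift γ) n ≡ γ
  reduce-lift γ = toℕ-injective (trans (toℕ-reduce (lift γ)) (m<n⇒m%n≡m (toℕ<n γ)))

x-y≡z⇒x≡y+z : ∀ x y {z} → x - y ≡ z → x ≡ y + z
x-y≡z⇒x≡y+z x y refl = split x y
  where
  split : ∀ x y → x ≡ y + (x - y)
  split = solve-∀

x-y≡z⇒y≡x-z : ∀ x y {z} → x - y ≡ z → y ≡ x - z
x-y≡z⇒y≡x-z x y refl = cancel x y
  where
  cancel : ∀ x y → y ≡ x - (x - y)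
  cancel = solve-∀

+2h≡2*h : ∀ h → + (2 ℕ.* h) ≡ + 2 * + h
+2h≡2*h h = ℤ.pos-* 2 h

+6h≡3*2*h : ∀ h → + (3 ℕ.* (2 ℕ.* h)) ≡ + 3 * (+ 2 * + h)
+6h≡3*2*h h = trans (ℤ.pos-* 3 (2 ℕ.* h)) (cong (+ 3 *_) (+2h≡2*h h))

residue-class-solution : ∀ {α β N b : ℤ} {h : ℕ} →
  (α≡β : α ≡ β mod 2) (3q₀+β≡N : + 3 * quotient α≡β + β ≡ N mod h) →
  b ≡ β - + 4 * quotient 3q₀+β≡N * + h mod (3 ℕ.* (2 ℕ.* h)) →
  Σ ℤ λ q → (N - b ≡ q * + 3) × (+ 2 * q + b ≡ α mod (2 ℕ.* h)) × (b ≡ β mod (2 ℕ.* h))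
residue-class-solution {α} {β} {N} {b} {h} (congruence q₀ α-β≡2q₀) (congruence k 3q₀+β-N≡kh)
                       (congruence j b-b₀≡6hj) =
  solve-for (x-y≡z⇒x≡y+z α β α-β≡2q₀) (x-y≡z⇒y≡x-z (+ 3 * q₀ + β) N 3q₀+β-N≡kh)
    (x-y≡z⇒x≡y+z b (β - + 4 * k * + h) (trans b-b₀≡6hj (cong (j *_) (+6h≡3*2*h h))))
  where
  solve-for : ∀ {N α b} → α ≡ β + q₀ * + 2 → N ≡ (+ 3 * q₀ + β) - k * + h →
    b ≡ (β - + 4 * k * + h) + j * (+ 3 * (+ 2 * + h)) →
    Σ ℤ λ q → (N - b ≡ q * + 3) × (+ 2 * q + b ≡ α mod (2 ℕ.* h)) × (b ≡ β mod (2 ℕ.* h))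
  solve-for refl refl refl =
    q₀ + k * + h - + 2 * + h * j , N-b≡q*3 β q₀ k j (+ h) ,
    congruence (j - k) (trans (2q+b-α≡[j-k]*2h β q₀ k j (+ h)) (cong ((j - k) *_) (sym (+2h≡2*h h)))) ,
    congruence (+ 3 * j - + 2 * k) (trans (b-β≡[3j-2k]*2h β k j (+ h)) (cong ((+ 3 * j - + 2 * k) *_) (sym (+2h≡2*h h))))
    where
    N-b≡q*3 : ∀ β q₀ k j H →
      ((+ 3 * q₀ + β) - k * H) - ((β - + 4 * k * H) + j * (+ 3 * (+ 2 * H)))
        ≡ (q₀ + k * H - + 2 * H * j) * + 3
    N-b≡q*3 = solve-∀
    2q+b-α≡[j-k]*2h : ∀ β q₀ k j H →
      (+ 2 * (q₀ + k * H - + 2 * H * j) + ((β - + 4 * k * H) + j * (+ 3 * (+ 2 * H))))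
        - (β + q₀ * + 2) ≡ (j - k) * (+ 2 * H)
    2q+b-α≡[j-k]*2h = solve-∀
    b-β≡[3j-2k]*2h : ∀ β k j H →
      ((β - + 4 * k * H) + j * (+ 3 * (+ 2 * H))) - β ≡ (+ 3 * j - + 2 * k) * (+ 2 * H)
    b-β≡[3j-2k]*2h = solve-∀

2q+b%2≡b%2 : ∀ q b → (+ 2 * q + b) %ℕ 2 ≡ b %ℕ 2
2q+b%2≡b%2 q b = ≡-mod⇒%ℕ-≡ (+ 2 * q + b) b (congruence q (drop-b q b))
  where
  drop-b : ∀ q b → (+ 2 * q + b) - b ≡ q * + 2
  drop-b = solve-∀

lemma3p4 : (h : ℕ) .{{_ : NonZero h}} (𝔖 : Fin (2 ℕ.* h) → Fin (2 ℕ.* h) → Set)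
    → CompleteResidues𝒩 𝔖
    → (N : ℕ) → Σ (Fin (3 ℕ.* (2 ℕ.* h))) λ r → (b : ℤ) → reduce₃ₛ h b ≡ r
    → Σ ℤ λ q → (+ N ℤ.- b ≡ q ℤ.* + 3)
        × (((+ 2 ℤ.* q ℤ.+ b) %ℕ 2 ≡ b %ℕ 2)
        × 𝔖 (reduceₛ h (+ 2 ℤ.* q ℤ.+ b)) (reduceₛ h b))
lemma3p4 h 𝔖 complete N
  with complete (reduce (+ N) h)
... | α , β , α,β∈𝔖 , _ , q₀ , α-β≡2q₀ , 3q₀+β≡N
  -- abstracted so that its quotient k is never unfolded (into /ℕ terms) during unification
  with reduce-injective (+ 3 * q₀ + lift β) (+ N) 3q₀+β≡N
... | 3q₀+β≡N[h] = reduce₃ₛ h b₀ , solution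
  where
  instance
    s≢0 : NonZero (2 ℕ.* h)
    s≢0 = nz-2* h
    3s≢0 : NonZero (3 ℕ.* (2 ℕ.* h))
    3s≢0 = nz-3* h

  α≡β : lift α ≡ lift β mod 2
  α≡β = congruence q₀ α-β≡2q₀

  b₀ : ℤ
  b₀ = lift β - + 4 * quotient 3q₀+β≡N[h] * + h

  solution : (b : ℤ) → reduce₃ₛ h b ≡ reduce₃ₛ h b₀
    → Σ ℤ λ q → (+ N ℤ.- b ≡ q ℤ.* + 3)
        × (((+ 2 ℤ.* q ℤ.+ b) %ℕ 2 ≡ b %ℕ 2)
        × 𝔖 (reduceₛ h (+ 2 ℤ.* q ℤ.+ b)) (reduceₛ h b))
  solution b b≡b₀ with residue-class-solution α≡β 3q₀+β≡N[h] (reduce-injective b b₀ b≡b₀)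
  ... | q , N-b≡3q , 2q+b≡α , b≡β =
    q , N-b≡3q , 2q+b%2≡b%2 q b ,
    subst₂ 𝔖 (sym (trans (reduce-cong 2q+b≡α) (reduce-lift α)))
             (sym (trans (reduce-cong b≡β) (reduce-lift β))) α,β∈𝔖
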